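{- For closed terms $M,N$ of the planar $\lambda$-calculus, $M=_{\beta\eta}N$ (in the planar $\lambda$-calculus) if and only if $[\![M]\!]_{\mathcal{A}}=[\![N]\!]_{\mathcal{A}}$ for every extensional $\mathbf{BI}(\_)^\bullet$-algebra $\mathcal{A}$.
   Context: An applicative structure is a set $\mathcal{A}$ with a binary operation written by juxtaposition, associating to the left. An extensional $\mathbf{BI}(\_)^\bullet$-algebra is an applicative structure $\mathcal{A}$ with elements $\mathbf{B},\mathbf{I}$ and a function $a\mapsto a^\bullet$ such that for all $a,b,c$: $\mathbf{I}\,a=a$; $\mathbf{B}\,a\,b\,c=a\,(b\,c)$; $a^\bullet\,b=b\,a$; $\mathbf{B}\,\mathbf{I}=\mathbf{I}$; $(a\,b)^\bullet=\mathbf{B}\,b^\bullet\,(\mathbf{B}\,a^\bullet\,\mathbf{B})$; $\mathbf{B}\,\mathbf{B}^\bullet\,(\mathbf{B}\,\mathbf{B}\,(\mathbf{B}\,\mathbf{B}\,\mathbf{B}))=\mathbf{B}\,(\mathbf{B}\,\mathbf{B})\,\mathbf{B}$; $\mathbf{B}\,\mathbf{I}^\bullet\,\mathbf{B}=\mathbf{I}$; $\mathbf{B}\,a^{\bullet\bullet}\,\mathbf{B}=\mathbf{B}\,(\mathbf{B}\,a^\bullet)\,\mathbf{B}$. The planar $\lambda$-calculus: untyped terms-in-context $\Gamma\vdash M$ ($\Gamma$ a list of distinct variables) generated by $x\vdash x$; from $\Gamma,x\vdash M$ infer $\Gamma\vdash\lambda x.M$; from $\Gamma\vdash M$ and $\Gamma'\vdash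 N$ infer $\Gamma,\Gamma'\vdash M\,N$ (each variable used exactly once, in order, no exchange). Equality $=_{\beta\eta}$ is the usual $\beta\eta$-equality (planar terms are closed under it). Interpretation: combinatory terms are built from variables, constants $\mathbf{B},\mathbf{I}$, application, and $t^\bullet$ for variable-free combinatory terms $t$. Translate $T(x)=x$, $T(M\,N)=T(M)\,T(N)$, $T(\lambda x.M)=\Lambda_x(T(M))$, where $\Lambda_x(x)=\mathbf{I}$, and $\Lambda_x(t_1\,t_2)=\mathbf{B}\,t_2^\bullet\,\Lambda_x(t_1)$ if $t_2$ contains no variable, and $\Lambda_x(t_1\,t_2)=\mathbf{B}\,t_1\,\Lambda_x(t_2)$ otherwise. For a closed planar term $M$, $[\![M]\!]_{\mathcal{A}}\in\mathcal{A}$ is the evaluation of the variable-free combinatory term $T(M)$ in $\mathcal{A}$. -}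

module Defs where

open import Data.Nat using (ℕ; zero; suc; pred; _<ᵇ_; _≡ᵇ_)
open import Data.Bool using (Bool; true; false; if_then_else_; _∧_)
open import Data.List using (List; []; _∷_; [_]; _++_; map)
open import Relation.Binary using (Rel; IsEquivalence)

data Term : Set where
  var : ℕ → Term
  lam : Term → Term
  app : Term → Term → Term

shift : ℕ → Term → Term
shift c (var k)   = if k <ᵇ c then var k else var (suc k)
shift c (lam M)   = lam (shift (suc c) M)
shift c (app M N) = app (shift c M) (shift c N)

subst : ℕ → Term → Term → Term
subst j N (var k)   = if k <ᵇ j then var k else (if k ≡ᵇ j then N else var (pred k))
subst j N (lam M)   = lam (subst (suc j) (shift 0 N) M)
subst j N (app M M') = app (subst j N M) (subst j N M')

-- A context Γ = x₁,…,xₙ is represented by the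
-- list of the de Bruijn indices of x₁,…,xₙ (in this order) at the
-- current depth; the newly bound variable of a λ is the last one
-- (index 0), and the outer variables are shifted by one.

data Planar : List ℕ → Term → Set where
  pvar : ∀ {k} → Planar [ k ] (var k)
  plam : ∀ {Γ M} → Planar (map suc Γ ++ [ 0 ]) M → Planar Γ (lam M)
  papp : ∀ {Γ Δ M N} → Planar Γ M → Planar Δ N → Planar (Γ ++ Δ) (app M N)

data _⊢_≐_ : List ℕ → Term → Term → Set where
  ≐-refl  : ∀ {Γ M} → Planar Γ M → Γ ⊢ M ≐ M
  ≐-sym   : ∀ {Γ M N} → Γ ⊢ M ≐ N → Γ ⊢ N ≐ M
  ≐-trans : ∀ {Γ M N P} → Γ ⊢ M ≐ N → Γ ⊢ N ≐ P → Γ ⊢ M ≐ P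
  ≐-lam   : ∀ {Γ M M'} → (map suc Γ ++ [ 0 ]) ⊢ M ≐ M' → Γ ⊢ lam M ≐ lam M'
  ≐-app   : ∀ {Γ Δ M M' N N'} → Γ ⊢ M ≐ M' → Δ ⊢ N ≐ N' →
            (Γ ++ Δ) ⊢ app M N ≐ app M' N'
  ≐-β     : ∀ {Γ Δ M N} → Planar (map suc Γ ++ [ 0 ]) M → Planar Δ N →
            (Γ ++ Δ) ⊢ app (lam M) N ≐ subst 0 N M
  ≐-η     : ∀ {Γ M} → Planar Γ M → Γ ⊢ lam (app (shift 0 M) (var 0)) ≐ M

record BIAlgebra : Set₁ where
  infixl 9 _∙_
  infix 10 _•
  infix 4 _≈_
  field
    Carrier       : Set
    _≈_           : Rel Carrier _
    isEquivalence : IsEquivalence _≈_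
    _∙_           : Carrier → Carrier → Carrier
    B I           : Carrier
    _•            : Carrier → Carrier
    ∙-cong        : ∀ {a a' b b'} → a ≈ a' → b ≈ b' → a ∙ b ≈ a' ∙ b'
    •-cong        : ∀ {a a'} → a ≈ a' → a • ≈ a' •
    I-ax          : ∀ a → I ∙ a ≈ a
    B-ax          : ∀ a b c → B ∙ a ∙ b ∙ c ≈ a ∙ (b ∙ c)
    •-ax          : ∀ a b → a • ∙ b ≈ b ∙ a
    BI-ax         : B ∙ I ≈ I
    •∙-ax         : ∀ a b → (a ∙ b) • ≈ B ∙ (b •) ∙ (B ∙ (a •) ∙ B)
    B•-ax         : B ∙ (B •) ∙ (B ∙ B ∙ (B ∙ B ∙ B)) ≈ B ∙ (B ∙ B) ∙ B
    I•-ax         : B ∙ (I •) ∙ B ≈ I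
    ••-ax         : ∀ a → B ∙ ((a •) •) ∙ B ≈ B ∙ (B ∙ (a •)) ∙ B

infixl 9 _⊙_
infix 10 _ᵒ
data CTm : Set where
  cvar : ℕ → CTm
  cB cI : CTm
  _⊙_  : CTm → CTm → CTm
  _ᵒ   : CTm → CTm

closedᵇ : CTm → Bool
closedᵇ (cvar _) = false
closedᵇ cB       = true
closedᵇ cI       = true
closedᵇ (t ⊙ u)  = closedᵇ t ∧ closedᵇ u
closedᵇ (t ᵒ)    = closedᵇ t

-- remove one binder: decrement variable indices (used on subterms not
-- containing the abstracted variable 0)
lower : CTm → CTm
lower (cvar k) = cvar (pred k)
lower cB       = cB
lower cI       = cI
lower (t ⊙ u)  = lower t ⊙ lower u
lower (t ᵒ)    = t ᵒ

-- Λ_x with x the variable of de Bruijn index 0.  Only the clauses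
-- Λ_x(x) and Λ_x(t₁ t₂) are meaningful; the remaining (default) clause
-- is never reached when translating planar terms.
Λ : CTm → CTm
Λ (cvar zero) = cI
Λ (t₁ ⊙ t₂)   = if closedᵇ t₂ then cB ⊙ (t₂ ᵒ) ⊙ Λ t₁ else cB ⊙ lower t₁ ⊙ Λ t₂
Λ t           = lower t

T : Term → CTm
T (var k)   = cvar k
T (app M N) = T M ⊙ T N
T (lam M)   = Λ (T M)

-- evaluation of variable-free combinatory terms (variables, which never
-- occur in T M for closed planar M, are sent to I)
eval : (𝒜 : BIAlgebra) → CTm → BIAlgebra.Carrier 𝒜
eval 𝒜 (cvar _) = BIAlgebra.I 𝒜
eval 𝒜 cB       = BIAlgebra.B 𝒜
eval 𝒜 cI       = BIAlgebra.I 𝒜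
eval 𝒜 (t ⊙ u)  = BIAlgebra._∙_ 𝒜 (eval 𝒜 t) (eval 𝒜 u)
eval 𝒜 (t ᵒ)    = BIAlgebra._• 𝒜 (eval 𝒜 t)

⟦_⟧_ : Term → (𝒜 : BIAlgebra) → BIAlgebra.Carrier 𝒜
⟦ M ⟧ 𝒜 = eval 𝒜 (T M)

{-# OPTIONS --safe #-}
-- Soundness: derivable equality of combinatory terms (the algebra axioms, with
-- congruence) holds in every algebra, so it suffices that T maps each βη-rule to a
-- derivable equation. The translation of a planar λ-body contains the abstracted
-- variable exactly once, as its last variable; on such terms Λ satisfies β
-- (Λ t u = t[u/0]) and respects derivable equality (the ξ-rule), and η becomes
-- B t I = t.
-- Completeness: closed planar terms modulo βη form an algebra, with
-- B = λxyz. x (y z), I = λx. x and a• = λx. x a. In it ⟦ M ⟧ is T M read back as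
-- a λ-term, and reading back undoes T up to βη.
module Submission where

open import Defs
open import Data.List using ([])
open import Function.Bundles using (_⇔_)

open import Data.Bool using (Bool; true; false; if_then_else_; _∧_; _∨_)
open import Data.Bool.Properties using (∧-zeroʳ; ∨-assoc; ∨-identityʳ; T-≡)
open import Data.Empty using (⊥-elim)
open import Data.List using (List; _∷_; [_]; _++_; map; null)
open import Data.List.Properties
  using (map-++; ++-assoc; ++-identityʳ; ++-conicalˡ; ++-conicalʳ; ∷-injective; ∷ʳ-injectiveˡ; map-injective)
open import Data.List.Relation.Unary.All using (All; []; _∷_)
open import Data.List.Relation.Unary.All.Properties using (++⁻)
open import Data.Nat using (ℕ; zero; suc; pred; _<ᵇ_; _≡ᵇ_; _<_; _≤_; z≤n; s≤s; z<s; s<s)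
open import Data.Nat.Properties using (<⇒<ᵇ; suc-injective)
open import Data.Product using (Σ; ∃; _×_; _,_; proj₁; proj₂)
open import Data.Unit using (⊤; tt)
open import Function.Bundles using (Equivalence; mk⇔)
open Equivalence using (to; from)
open import Function.Construct.Identity using (⇔-id)
open import Function.Construct.Symmetry using (⇔-sym)
open import Function.Construct.Composition using (_⇔-∘_)
open import Relation.Binary using (IsEquivalence)
open import Relation.Binary.PropositionalEquality as ≡ using (_≡_; _≢_; refl; sym; trans; cong; cong₂)
open ≡.≡-Reasoning

-- de Bruijn bookkeeping

⇑_ : List ℕ → List ℕ
⇑ Γ = map suc Γ ++ [ 0 ]

⇑-++ : ∀ Γ Δ → map suc Γ ++ ⇑ Δ ≡ ⇑ (Γ ++ Δ)
⇑-++ []      Δ = refl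
⇑-++ (x ∷ Γ) Δ = cong (suc x ∷_) (⇑-++ Γ Δ)

⇑-injective : ∀ Γ Δ → ⇑ Γ ≡ ⇑ Δ → Γ ≡ Δ
⇑-injective Γ Δ e = map-injective suc-injective (∷ʳ-injectiveˡ (map suc Γ) (map suc Δ) e)

<⇒<ᵇ≡true : ∀ {k c} → k < c → (k <ᵇ c) ≡ true
<⇒<ᵇ≡true k<c = Equivalence.to T-≡ (<⇒<ᵇ k<c)

All<-⇑ : ∀ {c} Γ → All (_< c) Γ → All (_< suc c) (⇑ Γ)
All<-⇑ []      []       = z<s ∷ []
All<-⇑ (_ ∷ Γ) (p ∷ ps) = s<s p ∷ All<-⇑ Γ ps

shift-fresh : ∀ {Γ M} c → Planar Γ M → All (_< c) Γ → shift c M ≡ M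
shift-fresh c pvar         (k<c ∷ []) rewrite <⇒<ᵇ≡true k<c = refl
shift-fresh c (plam {Γ} p) a = cong lam (shift-fresh (suc c) p (All<-⇑ Γ a))
shift-fresh c (papp {Γ} p q) a =
  let a₁ , a₂ = ++⁻ Γ a in cong₂ app (shift-fresh c p a₁) (shift-fresh c q a₂)

subst-fresh : ∀ {Γ M} j N → Planar Γ M → All (_< j) Γ → subst j N M ≡ M
subst-fresh j N pvar         (k<j ∷ []) rewrite <⇒<ᵇ≡true k<j = refl
subst-fresh j N (plam {Γ} p) a = cong lam (subst-fresh (suc j) (shift 0 N) p (All<-⇑ Γ a))
subst-fresh j N (papp {Γ} p q) a =
  let a₁ , a₂ = ++⁻ Γ a in cong₂ app (subst-fresh j N p a₁) (subst-fresh j N q a₂)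

shift-closed : ∀ {M} c → Planar [] M → shift c M ≡ M
shift-closed c p = shift-fresh c p []

subst-closed : ∀ {M} j N → Planar [] M → subst j N M ≡ M
subst-closed j N p = subst-fresh j N p []

shiftVar : ℕ → ℕ → ℕ
shiftVar c k = if k <ᵇ c then k else suc k

shift-var : ∀ c k → shift c (var k) ≡ var (shiftVar c k)
shift-var c k with k <ᵇ c
... | true  = refl
... | false = refl

shiftVar-suc : ∀ c k → shiftVar (suc c) (suc k) ≡ suc (shiftVar c k)
shiftVar-suc c k with k <ᵇ c
... | true  = refl
... | false = refl

shiftVar-comm : ∀ d c k → d ≤ c → shiftVar (suc c) (shiftVar d k) ≡ shiftVar d (shiftVar c k)
shiftVar-comm zero    c       k       _         = shiftVar-suc c k
shiftVar-comm (suc d) (suc c) zero    _         = refl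
shiftVar-comm (suc d) (suc c) (suc k) (s≤s d≤c) = begin
  shiftVar (suc (suc c)) (shiftVar (suc d) (suc k)) ≡⟨ cong (shiftVar (suc (suc c))) (shiftVar-suc d k) ⟩
  shiftVar (suc (suc c)) (suc (shiftVar d k))       ≡⟨ shiftVar-suc (suc c) (shiftVar d k) ⟩
  suc (shiftVar (suc c) (shiftVar d k))             ≡⟨ cong suc (shiftVar-comm d c k d≤c) ⟩
  suc (shiftVar d (shiftVar c k))                   ≡⟨ sym (shiftVar-suc d (shiftVar c k)) ⟩
  shiftVar (suc d) (suc (shiftVar c k))             ≡⟨ cong (shiftVar (suc d)) (sym (shiftVar-suc c k)) ⟩
  shiftVar (suc d) (shiftVar (suc c) (suc k))       ∎

shift-comm : ∀ d c M → d ≤ c → shift (suc c) (shift d M) ≡ shift d (shift c M)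
shift-comm d c (var k) d≤c = begin
  shift (suc c) (shift d (var k))        ≡⟨ cong (shift (suc c)) (shift-var d k) ⟩
  shift (suc c) (var (shiftVar d k))     ≡⟨ shift-var (suc c) (shiftVar d k) ⟩
  var (shiftVar (suc c) (shiftVar d k))  ≡⟨ cong var (shiftVar-comm d c k d≤c) ⟩
  var (shiftVar d (shiftVar c k))        ≡⟨ sym (shift-var d (shiftVar c k)) ⟩
  shift d (var (shiftVar c k))           ≡⟨ cong (shift d) (sym (shift-var c k)) ⟩
  shift d (shift c (var k))              ∎
shift-comm d c (lam M)   d≤c = cong lam (shift-comm (suc d) (suc c) M (s≤s d≤c))
shift-comm d c (app M N) d≤c = cong₂ app (shift-comm d c M d≤c) (shift-comm d c N d≤c)

≮ᵇ-suc : ∀ k c → (k <ᵇ c) ≡ false → (suc k <ᵇ c) ≡ false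
≮ᵇ-suc k       zero    _ = refl
≮ᵇ-suc (suc k) (suc c) e = ≮ᵇ-suc k c e

≮ᵇ⇒suc≢ᵇ : ∀ k c → (k <ᵇ c) ≡ false → (suc k ≡ᵇ c) ≡ false
≮ᵇ⇒suc≢ᵇ k       zero    _ = refl
≮ᵇ⇒suc≢ᵇ (suc k) (suc c) e = ≮ᵇ⇒suc≢ᵇ k c e

subst-shift : ∀ c X M → subst c X (shift c M) ≡ M
subst-shift c X (var k) with k <ᵇ c in k≮c
... | true rewrite k≮c = refl
... | false rewrite ≮ᵇ-suc k c k≮c | ≮ᵇ⇒suc≢ᵇ k c k≮c = refl
subst-shift c X (lam M)   = cong lam (subst-shift (suc c) (shift 0 X) M)
subst-shift c X (app M N) = cong₂ app (subst-shift c X M) (subst-shift c X N)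

subst-var-shift : ∀ c M → subst c (var c) (shift (suc c) M) ≡ M
subst-var-shift c (var k)   = trans (cong (subst c (var c)) (shift-var (suc c) k)) (on-var c k)
  where
  suc-var : Term → Term
  suc-var (var k) = var (suc k)
  suc-var M       = M
  subst-suc : ∀ c k X → subst (suc c) (suc-var X) (var (suc k)) ≡ suc-var (subst c X (var k))
  subst-suc zero    zero    X = refl
  subst-suc (suc c) zero    X = refl
  subst-suc c       (suc k) X with suc k <ᵇ c
  ... | true  = refl
  ... | false with suc k ≡ᵇ c
  ...   | true  = refl
  ...   | false = refl
  on-var : ∀ c k → subst c (var c) (var (shiftVar (suc c) k)) ≡ var k
  on-var zero    zero    = refl
  on-var zero    (suc k) = refl
  on-var (suc c) zero    = refl
  on-var (suc c) (suc k) = begin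
    subst (suc c) (var (suc c)) (var (shiftVar (suc (suc c)) (suc k)))
      ≡⟨ cong (λ i → subst (suc c) (var (suc c)) (var i)) (shiftVar-suc (suc c) k) ⟩
    subst (suc c) (var (suc c)) (var (suc (shiftVar (suc c) k)))
      ≡⟨ subst-suc c (shiftVar (suc c) k) (var c) ⟩
    suc-var (subst c (var c) (var (shiftVar (suc c) k)))
      ≡⟨ cong suc-var (on-var c k) ⟩
    var (suc k) ∎
subst-var-shift c (lam M)   = cong lam (subst-var-shift (suc c) M)
subst-var-shift c (app M N) = cong₂ app (subst-var-shift c M) (subst-var-shift c N)

map-shiftVar-⇑ : ∀ c Γ → map (shiftVar (suc c)) (⇑ Γ) ≡ ⇑ map (shiftVar c) Γ
map-shiftVar-⇑ c []      = refl
map-shiftVar-⇑ c (x ∷ Γ) = cong₂ _∷_ (shiftVar-suc c x) (map-shiftVar-⇑ c Γ)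

cast-planar : ∀ {Γ Δ M} → Γ ≡ Δ → Planar Γ M → Planar Δ M
cast-planar refl p = p

planar-shift : ∀ {Γ M} c → Planar Γ M → Planar (map (shiftVar c) Γ) (shift c M)
planar-shift c (pvar {k})         = ≡.subst (Planar [ shiftVar c k ]) (sym (shift-var c k)) pvar
planar-shift c (plam {Γ} p)       = plam (cast-planar (map-shiftVar-⇑ c Γ) (planar-shift (suc c) p))
planar-shift c (papp {Γ} {Δ} p q) =
  cast-planar (sym (map-++ (shiftVar c) Γ Δ)) (papp (planar-shift c p) (planar-shift c q))

-- The term model

Bᵗ Iᵗ : Term
Bᵗ = lam (lam (lam (app (var 2) (app (var 1) (var 0)))))
Iᵗ = lam (var 0)

infix 10 _•ᵗ
_•ᵗ : Term → Term
a •ᵗ = lam (app (var 0) a)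

Bᵗ-planar : Planar [] Bᵗ
Bᵗ-planar = plam (plam (plam (papp pvar (papp pvar pvar))))

Iᵗ-planar : Planar [] Iᵗ
Iᵗ-planar = plam pvar

•ᵗ-planar : ∀ {a} → Planar [] a → Planar [] (a •ᵗ)
•ᵗ-planar p = plam (papp pvar p)

infixr 4 _⨾_
_⨾_ : ∀ {Γ M N P} → Γ ⊢ M ≐ N → Γ ⊢ N ≐ P → Γ ⊢ M ≐ P
_⨾_ = ≐-trans

cast-≐ : ∀ {Γ Δ M N} → Γ ≡ Δ → Γ ⊢ M ≐ N → Δ ⊢ M ≐ N
cast-≐ refl e = e

≐-≡ʳ : ∀ {Γ M N N'} → N ≡ N' → Γ ⊢ M ≐ N → Γ ⊢ M ≐ N'
≐-≡ʳ refl e = e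

≐-β≡ : ∀ {Γ Δ M N R} → Planar (⇑ Γ) M → Planar Δ N → subst 0 N M ≡ R → (Γ ++ Δ) ⊢ app (lam M) N ≐ R
≐-β≡ p q refl = ≐-β p q

Bᵗ-app₂ : ∀ {Γ₁ Γ₂ F G} → Planar Γ₁ F → Planar Γ₂ G →
          (Γ₁ ++ Γ₂) ⊢ app (app Bᵗ F) G ≐ lam (app (shift 0 F) (app (shift 0 G) (var 0)))
Bᵗ-app₂ {Γ₁} {Γ₂} {F} {G} p q =
  ≐-app (≐-β {Γ = []} (plam (plam (papp pvar (papp pvar pvar)))) p) (≐-refl q)
  ⨾ ≐-β≡ {Γ = Γ₁} (plam (cast-planar (⇑⇑ Γ₁) (papp (planar-shift 0 (planar-shift 0 p)) (papp pvar pvar)))) q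
         (cong (λ F' → lam (app F' (app (shift 0 G) (var 0)))) subst-shift-shift)
  where
  ⇑⇑ : ∀ Γ → map suc (map suc Γ) ++ (1 ∷ 0 ∷ []) ≡ ⇑ ⇑ Γ
  ⇑⇑ []      = refl
  ⇑⇑ (x ∷ Γ) = cong (suc (suc x) ∷_) (⇑⇑ Γ)
  subst-shift-shift : subst 1 (shift 0 G) (shift 0 (shift 0 F)) ≡ shift 0 F
  subst-shift-shift =
    trans (cong (subst 1 (shift 0 G)) (sym (shift-comm 0 0 F z≤n))) (subst-shift 1 (shift 0 G) (shift 0 F))

Bᵗ-app₃ : ∀ {Γ₁ Γ₂ Γ₃ F G H} → Planar Γ₁ F → Planar Γ₂ G → Planar Γ₃ H →
          ((Γ₁ ++ Γ₂) ++ Γ₃) ⊢ app (app (app Bᵗ F) G) H ≐ app F (app G H)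
Bᵗ-app₃ {Γ₁} {Γ₂} {F = F} {G} {H} p q r =
  ≐-app (Bᵗ-app₂ p q) (≐-refl r)
  ⨾ ≐-β≡ {Γ = Γ₁ ++ Γ₂} (cast-planar (⇑-++ Γ₁ Γ₂) (papp (planar-shift 0 p) (papp (planar-shift 0 q) pvar))) r
         (cong₂ (λ F' G' → app F' (app G' H)) (subst-shift 0 H F) (subst-shift 0 H G))

Bᵗ-app-lam : ∀ {Γ₁ Γ₂ F G} → Planar Γ₁ F → Planar (⇑ Γ₂) G →
             (Γ₁ ++ Γ₂) ⊢ app (app Bᵗ F) (lam G) ≐ lam (app (shift 0 F) G)
Bᵗ-app-lam {Γ₁} {Γ₂} {F} {G} p q =
  Bᵗ-app₂ p (plam q)
  ⨾ ≐-lam (cast-≐ (⇑-++ Γ₁ Γ₂)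
      (≐-app {Γ = map suc Γ₁} (≐-refl (planar-shift 0 p))
        (≐-β≡ {Γ = map suc Γ₂} (cast-planar (map-shiftVar-⇑ 0 Γ₂) (planar-shift 1 q)) pvar (subst-var-shift 0 G))))

Iᵗ-β : ∀ {a} → Planar [] a → [] ⊢ app Iᵗ a ≐ a
Iᵗ-β pa = ≐-β {Γ = []} pvar pa

•ᵗ-β : ∀ {a b} → Planar [] a → Planar [] b → [] ⊢ app (a •ᵗ) b ≐ app b a
•ᵗ-β {b = b} pa pb = ≐-β≡ {Γ = []} (papp pvar pa) pb (cong (app b) (subst-closed 0 b pa))

Bᵗ-Iᵗ : [] ⊢ app Bᵗ Iᵗ ≐ Iᵗ
Bᵗ-Iᵗ =
  ≐-β {Γ = []} {Δ = []} (plam (plam (papp pvar (papp pvar pvar)))) Iᵗ-planar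
  ⨾ ≐-lam {Γ = []} (≐-lam {Γ = [ 0 ]} (≐-β {Γ = []} {Δ = 1 ∷ 0 ∷ []} pvar (papp pvar pvar)) ⨾ ≐-η {Γ = [ 0 ]} pvar)

•ᵗ-app : ∀ {a b} → Planar [] a → Planar [] b →
         [] ⊢ (app a b) •ᵗ ≐ app (app Bᵗ (b •ᵗ)) (app (app Bᵗ (a •ᵗ)) Bᵗ)
•ᵗ-app {a} {b} pa pb = ≐-sym
  (≐-≡ʳ (cong₂ (λ y z → lam (app y (app z (var 0)))) (shift-closed 0 (•ᵗ-planar pb)) (shift-closed 0 Ba•B-planar))
     (Bᵗ-app₂ {Γ₁ = []} {Γ₂ = []} (•ᵗ-planar pb) Ba•B-planar)
  ⨾ ≐-lam {Γ = []}
     (≐-β≡ {Γ = []} {Δ = [ 0 ]} (papp pvar pb) (papp Ba•B-planar pvar) (cong (app _) (subst-closed 0 _ pb))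
     ⨾ ≐-app {Γ = [ 0 ]} {Δ = []} (Bᵗ-app₃ {Γ₁ = []} {Γ₂ = []} (•ᵗ-planar pa) Bᵗ-planar pvar) (≐-refl pb)
     ⨾ ≐-app {Γ = [ 0 ]} {Δ = []}
         (≐-β≡ {Γ = []} {Δ = [ 0 ]} (papp pvar pa) (papp Bᵗ-planar pvar) (cong (app _) (subst-closed 0 _ pa)))
         (≐-refl pb)
     ⨾ Bᵗ-app₃ {Γ₁ = [ 0 ]} {Γ₂ = []} {Γ₃ = []} pvar pa pb))
  where
  Ba•B-planar : Planar [] (app (app Bᵗ (a •ᵗ)) Bᵗ)
  Ba•B-planar = papp (papp Bᵗ-planar (•ᵗ-planar pa)) Bᵗ-planar

-- Both sides are βη-equal to λxyzw. x (y (z w)).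
Bᵗ-Bᵗ•-law : [] ⊢ app (app Bᵗ (Bᵗ •ᵗ)) (app (app Bᵗ Bᵗ) (app (app Bᵗ Bᵗ) Bᵗ)) ≐ app (app Bᵗ (app Bᵗ Bᵗ)) Bᵗ
Bᵗ-Bᵗ•-law = lhs ⨾ ≐-sym rhs
  where
  BB : Planar [] (app Bᵗ Bᵗ)
  BB = papp Bᵗ-planar Bᵗ-planar
  BBB : Planar [] (app (app Bᵗ Bᵗ) Bᵗ)
  BBB = papp BB Bᵗ-planar
  B∘₃ : Term
  B∘₃ = lam (lam (lam (lam (app (var 3) (app (var 2) (app (var 1) (var 0)))))))
  B-B-B : (1 ∷ 0 ∷ []) ⊢ app (app Bᵗ (app Bᵗ (var 1))) (app Bᵗ (var 0))
                        ≐ lam (lam (app (var 3) (app (var 2) (app (var 1) (var 0)))))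
  B-B-B = Bᵗ-app₂ {Γ₁ = [ 1 ]} {Γ₂ = [ 0 ]} (papp Bᵗ-planar pvar) (papp Bᵗ-planar pvar)
    ⨾ ≐-lam {Γ = 1 ∷ 0 ∷ []}
       (Bᵗ-app₂ {Γ₁ = [ 2 ]} {Γ₂ = 1 ∷ 0 ∷ []} pvar (papp (papp Bᵗ-planar pvar) pvar)
       ⨾ ≐-lam {Γ = 2 ∷ 1 ∷ 0 ∷ []}
          (≐-app {Γ = [ 3 ]} {Δ = 2 ∷ 1 ∷ 0 ∷ []} (≐-refl pvar)
            (Bᵗ-app₃ {Γ₁ = [ 2 ]} {Γ₂ = [ 1 ]} {Γ₃ = [ 0 ]} pvar pvar pvar)))
  B-BB : (1 ∷ 0 ∷ []) ⊢ app Bᵗ (app (app Bᵗ (var 1)) (var 0))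
                       ≐ lam (lam (app (var 3) (app (var 2) (app (var 1) (var 0)))))
  B-BB = ≐-sym (≐-η {Γ = 1 ∷ 0 ∷ []} (papp Bᵗ-planar (papp (papp Bᵗ-planar pvar) pvar)))
    ⨾ ≐-lam {Γ = 1 ∷ 0 ∷ []}
       (Bᵗ-app₂ {Γ₁ = 2 ∷ 1 ∷ []} {Γ₂ = [ 0 ]} (papp (papp Bᵗ-planar pvar) pvar) pvar
       ⨾ ≐-lam {Γ = 2 ∷ 1 ∷ 0 ∷ []} (Bᵗ-app₃ {Γ₁ = [ 3 ]} {Γ₂ = [ 2 ]} {Γ₃ = 1 ∷ 0 ∷ []} pvar pvar (papp pvar pvar)))
  lhs : [] ⊢ app (app Bᵗ (Bᵗ •ᵗ)) (app (app Bᵗ Bᵗ) (app (app Bᵗ Bᵗ) Bᵗ)) ≐ B∘₃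
  lhs = Bᵗ-app₂ {Γ₁ = []} {Γ₂ = []} (•ᵗ-planar Bᵗ-planar) (papp BB BBB)
    ⨾ ≐-lam {Γ = []}
       (≐-β {Γ = []} {Δ = [ 0 ]} (papp pvar Bᵗ-planar) (papp (papp BB BBB) pvar)
       ⨾ ≐-app {Γ = [ 0 ]} {Δ = []} (Bᵗ-app₃ {Γ₁ = []} {Γ₂ = []} {Γ₃ = [ 0 ]} Bᵗ-planar BBB pvar) (≐-refl Bᵗ-planar)
       ⨾ Bᵗ-app₂ {Γ₁ = [ 0 ]} {Γ₂ = []} (papp BBB pvar) Bᵗ-planar
       ⨾ ≐-lam {Γ = [ 0 ]}
          (≐-app {Γ = [ 1 ]} {Δ = [ 0 ]} (Bᵗ-app₃ {Γ₁ = []} {Γ₂ = []} {Γ₃ = [ 1 ]} Bᵗ-planar Bᵗ-planar pvar)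
                 (≐-refl (papp Bᵗ-planar pvar))
          ⨾ B-B-B))
  rhs : [] ⊢ app (app Bᵗ (app Bᵗ Bᵗ)) Bᵗ ≐ B∘₃
  rhs = Bᵗ-app₂ {Γ₁ = []} {Γ₂ = []} BB Bᵗ-planar
    ⨾ ≐-lam {Γ = []} (Bᵗ-app₂ {Γ₁ = []} {Γ₂ = [ 0 ]} Bᵗ-planar (papp Bᵗ-planar pvar) ⨾ ≐-lam {Γ = [ 0 ]} B-BB)

Bᵗ-Iᵗ•-law : [] ⊢ app (app Bᵗ (Iᵗ •ᵗ)) Bᵗ ≐ Iᵗ
Bᵗ-Iᵗ•-law = Bᵗ-app₂ {Γ₁ = []} {Γ₂ = []} (•ᵗ-planar Iᵗ-planar) Bᵗ-planar
  ⨾ ≐-lam {Γ = []}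
     (≐-β {Γ = []} {Δ = [ 0 ]} (papp pvar Iᵗ-planar) (papp Bᵗ-planar pvar)
     ⨾ Bᵗ-app₂ {Γ₁ = [ 0 ]} {Γ₂ = []} pvar Iᵗ-planar
     ⨾ ≐-lam {Γ = [ 0 ]} (≐-app {Γ = [ 1 ]} {Δ = [ 0 ]} (≐-refl pvar) (≐-β {Γ = []} {Δ = [ 0 ]} pvar pvar))
     ⨾ ≐-η {Γ = [ 0 ]} pvar)

-- Both sides are βη-equal to λxy. x (y a).
Bᵗ-••-law : ∀ {a} → Planar [] a → [] ⊢ app (app Bᵗ ((a •ᵗ) •ᵗ)) Bᵗ ≐ app (app Bᵗ (app Bᵗ (a •ᵗ))) Bᵗ
Bᵗ-••-law {a} pa = lhs ⨾ ≐-sym rhs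
  where
  x[ya] : Term
  x[ya] = lam (lam (app (var 1) (app (var 0) a)))
  lhs : [] ⊢ app (app Bᵗ ((a •ᵗ) •ᵗ)) Bᵗ ≐ x[ya]
  lhs = ≐-≡ʳ (cong (λ z → lam (app z (app Bᵗ (var 0)))) (shift-closed 0 (•ᵗ-planar (•ᵗ-planar pa))))
          (Bᵗ-app₂ {Γ₁ = []} {Γ₂ = []} (•ᵗ-planar (•ᵗ-planar pa)) Bᵗ-planar)
    ⨾ ≐-lam {Γ = []}
       (≐-β≡ {Γ = []} {Δ = [ 0 ]} (papp pvar (•ᵗ-planar pa)) (papp Bᵗ-planar pvar)
             (cong (app (app Bᵗ (var 0))) (subst-closed 0 (app Bᵗ (var 0)) (•ᵗ-planar pa)))
       ⨾ ≐-≡ʳ (cong (λ z → lam (app (var 1) (app z (var 0)))) (shift-closed 0 (•ᵗ-planar pa)))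
           (Bᵗ-app₂ {Γ₁ = [ 0 ]} {Γ₂ = []} pvar (•ᵗ-planar pa))
       ⨾ ≐-lam {Γ = [ 0 ]} (≐-app {Γ = [ 1 ]} {Δ = [ 0 ]} (≐-refl pvar)
            (≐-β≡ {Γ = []} {Δ = [ 0 ]} (papp pvar pa) pvar (cong (app (var 0)) (subst-closed 0 _ pa)))))
  rhs : [] ⊢ app (app Bᵗ (app Bᵗ (a •ᵗ))) Bᵗ ≐ x[ya]
  rhs = ≐-≡ʳ (cong (λ z → lam (app z (app Bᵗ (var 0)))) (shift-closed 0 (papp Bᵗ-planar (•ᵗ-planar pa))))
          (Bᵗ-app₂ {Γ₁ = []} {Γ₂ = []} (papp Bᵗ-planar (•ᵗ-planar pa)) Bᵗ-planar)
    ⨾ ≐-lam {Γ = []}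
       (≐-≡ʳ (cong (λ z → lam (app z (app (app Bᵗ (var 1)) (var 0)))) (shift-closed 0 (•ᵗ-planar pa)))
          (Bᵗ-app₂ {Γ₁ = []} {Γ₂ = [ 0 ]} {F = a •ᵗ} {G = app Bᵗ (var 0)} (•ᵗ-planar pa) (papp Bᵗ-planar pvar))
       ⨾ ≐-lam {Γ = [ 0 ]}
          (≐-β≡ {Γ = []} {Δ = 1 ∷ 0 ∷ []} (papp pvar pa) (papp (papp Bᵗ-planar pvar) pvar)
                (cong (app (app (app Bᵗ (var 1)) (var 0))) (subst-closed 0 _ pa))
          ⨾ Bᵗ-app₃ {Γ₁ = [ 1 ]} {Γ₂ = [ 0 ]} {Γ₃ = []} pvar pvar pa))

ClosedTerm : Set
ClosedTerm = Σ Term (Planar [])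

termModel : BIAlgebra
termModel = record
  { Carrier       = ClosedTerm
  ; _≈_           = λ (M , _) (N , _) → [] ⊢ M ≐ N
  ; isEquivalence = record { refl = λ {(_ , p)} → ≐-refl p ; sym = ≐-sym ; trans = ≐-trans }
  ; _∙_           = λ (M , p) (N , q) → app M N , papp p q
  ; B             = Bᵗ , Bᵗ-planar
  ; I             = Iᵗ , Iᵗ-planar
  ; _•            = λ (M , p) → M •ᵗ , •ᵗ-planar p
  ; ∙-cong        = ≐-app {Γ = []} {Δ = []}
  ; •-cong        = λ e → ≐-lam {Γ = []} (≐-app {Γ = [ 0 ]} {Δ = []} (≐-refl pvar) e)
  ; I-ax          = λ (_ , p) → Iᵗ-β p
  ; B-ax          = λ (_ , p) (_ , q) (_ , r) → Bᵗ-app₃ p q r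
  ; •-ax          = λ (_ , p) (_ , q) → •ᵗ-β p q
  ; BI-ax         = Bᵗ-Iᵗ
  ; •∙-ax         = λ (_ , p) (_ , q) → •ᵗ-app p q
  ; B•-ax         = Bᵗ-Bᵗ•-law
  ; I•-ax         = Bᵗ-Iᵗ•-law
  ; ••-ax         = λ (_ , p) → Bᵗ-••-law p
  }

-- Combinatory terms

∧≡true⁻ : ∀ {a b} → a ∧ b ≡ true → a ≡ true × b ≡ true
∧≡true⁻ {true} b≡true = refl , b≡true

∧≡true⁺ : ∀ {a b} → a ≡ true → b ≡ true → a ∧ b ≡ true
∧≡true⁺ refl b≡true = b≡true

∧≡falseʳ : ∀ {a b} → b ≡ false → a ∧ b ≡ false
∧≡falseʳ {a} refl = ∧-zeroʳ a

∧≡falseˡ : ∀ {a b} → a ≡ false → a ∧ b ≡ false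
∧≡falseˡ refl = refl

∨≡false⁻ : ∀ {a b} → a ∨ b ≡ false → a ≡ false × b ≡ false
∨≡false⁻ {false} b≡false = refl , b≡false

vars : CTm → List ℕ
vars (cvar k) = [ k ]
vars cB       = []
vars cI       = []
vars (t ⊙ u)  = vars t ++ vars u
vars (t ᵒ)    = vars t

-- the paper only forms t• for variable-free t
DotsClosed : CTm → Set
DotsClosed (t ⊙ u) = DotsClosed t × DotsClosed u
DotsClosed (t ᵒ)   = closedᵇ t ≡ true
DotsClosed _       = ⊤

has0 : CTm → Bool
has0 (cvar zero)    = true
has0 (cvar (suc _)) = false
has0 (t ⊙ u)        = has0 t ∨ has0 u
has0 _              = false

cshift : ℕ → CTm → CTm
cshift c (cvar k) = cvar (shiftVar c k)
cshift c (t ⊙ u)  = cshift c t ⊙ cshift c u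
cshift c t        = t

csub : ℕ → CTm → CTm → CTm
csub j u (cvar k)  = if k <ᵇ j then cvar k else (if k ≡ᵇ j then u else cvar (pred k))
csub j u (t ⊙ t')  = csub j u t ⊙ csub j u t'
csub j u t         = t

vars≡[]⇒closed : ∀ t → vars t ≡ [] → closedᵇ t ≡ true
vars≡[]⇒closed cB       _ = refl
vars≡[]⇒closed cI       _ = refl
vars≡[]⇒closed (t ⊙ u)  e rewrite vars≡[]⇒closed t (++-conicalˡ (vars t) (vars u) e) =
  vars≡[]⇒closed u (++-conicalʳ (vars t) (vars u) e)
vars≡[]⇒closed (t ᵒ)    e = vars≡[]⇒closed t e

closed⇒vars≡[] : ∀ t → closedᵇ t ≡ true → vars t ≡ []
closed⇒vars≡[] cB      _ = refl
closed⇒vars≡[] cI      _ = refl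
closed⇒vars≡[] (t ⊙ u) e =
  let et , eu = ∧≡true⁻ e in cong₂ _++_ (closed⇒vars≡[] t et) (closed⇒vars≡[] u eu)
closed⇒vars≡[] (t ᵒ)   e = closed⇒vars≡[] t e

closedᵇ≡null-vars : ∀ t → closedᵇ t ≡ null (vars t)
closedᵇ≡null-vars t with vars t in vs | closedᵇ t in ct
... | []    | true  = refl
... | []    | false = trans (sym ct) (vars≡[]⇒closed t vs)
... | _ ∷ _ | true  with () ← trans (sym vs) (closed⇒vars≡[] t ct)
... | _ ∷ _ | false = refl

closed⇒has0≡false : ∀ t → closedᵇ t ≡ true → has0 t ≡ false
closed⇒has0≡false cB      _ = refl
closed⇒has0≡false cI      _ = refl
closed⇒has0≡false (t ⊙ u) e =
  let et , eu = ∧≡true⁻ e in cong₂ _∨_ (closed⇒has0≡false t et) (closed⇒has0≡false u eu)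
closed⇒has0≡false (t ᵒ)   _ = refl

closed⇒DotsClosed : ∀ t → closedᵇ t ≡ true → DotsClosed t
closed⇒DotsClosed cB      _ = tt
closed⇒DotsClosed cI      _ = tt
closed⇒DotsClosed (t ⊙ u) e = let et , eu = ∧≡true⁻ e in closed⇒DotsClosed t et , closed⇒DotsClosed u eu
closed⇒DotsClosed (t ᵒ)   e = e

lower-closed : ∀ t → closedᵇ t ≡ true → lower t ≡ t
lower-closed cB      _ = refl
lower-closed cI      _ = refl
lower-closed (t ⊙ u) e = let et , eu = ∧≡true⁻ e in cong₂ _⊙_ (lower-closed t et) (lower-closed u eu)
lower-closed (t ᵒ)   _ = refl

cshift-closed : ∀ c t → closedᵇ t ≡ true → cshift c t ≡ t
cshift-closed c cB      _ = refl
cshift-closed c cI      _ = refl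
cshift-closed c (t ⊙ u) e = let et , eu = ∧≡true⁻ e in cong₂ _⊙_ (cshift-closed c t et) (cshift-closed c u eu)
cshift-closed c (t ᵒ)   _ = refl

csub-closed : ∀ j u t → closedᵇ t ≡ true → csub j u t ≡ t
csub-closed j u cB       _ = refl
csub-closed j u cI       _ = refl
csub-closed j u (t ⊙ t') e = let et , et' = ∧≡true⁻ e in cong₂ _⊙_ (csub-closed j u t et) (csub-closed j u t' et')
csub-closed j u (t ᵒ)    _ = refl

closedᵇ-cshift : ∀ c t → closedᵇ (cshift c t) ≡ closedᵇ t
closedᵇ-cshift c (cvar _) = refl
closedᵇ-cshift c cB       = refl
closedᵇ-cshift c cI       = refl
closedᵇ-cshift c (t ⊙ u)  = cong₂ _∧_ (closedᵇ-cshift c t) (closedᵇ-cshift c u)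
closedᵇ-cshift c (t ᵒ)    = refl

has0-cshift : ∀ c t → has0 (cshift (suc c) t) ≡ has0 t
has0-cshift c (cvar zero)    = refl
has0-cshift c (cvar (suc k)) rewrite shiftVar-suc c k = refl
has0-cshift c cB             = refl
has0-cshift c cI             = refl
has0-cshift c (t ⊙ u)        = cong₂ _∨_ (has0-cshift c t) (has0-cshift c u)
has0-cshift c (t ᵒ)          = refl

lower-cshift0 : ∀ t → lower (cshift 0 t) ≡ t
lower-cshift0 (cvar k) = refl
lower-cshift0 cB       = refl
lower-cshift0 cI       = refl
lower-cshift0 (t ⊙ u)  = cong₂ _⊙_ (lower-cshift0 t) (lower-cshift0 u)
lower-cshift0 (t ᵒ)    = refl

lower-cshift : ∀ c t → has0 t ≡ false → lower (cshift (suc c) t) ≡ cshift c (lower t)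
lower-cshift c (cvar (suc k)) _ = cong (λ i → cvar (pred i)) (shiftVar-suc c k)
lower-cshift c cB             _ = refl
lower-cshift c cI             _ = refl
lower-cshift c (t ⊙ u)        e = let et , eu = ∨≡false⁻ e in cong₂ _⊙_ (lower-cshift c t et) (lower-cshift c u eu)
lower-cshift c (t ᵒ)          _ = refl

lower-csub : ∀ j u t → has0 t ≡ false → lower (csub (suc j) (cshift 0 u) t) ≡ csub j u (lower t)
lower-csub j u (cvar (suc k)) _ with k <ᵇ j
... | true = refl
... | false with k ≡ᵇ j
...   | true  = lower-cshift0 u
...   | false = refl
lower-csub j u cB       _ = refl
lower-csub j u cI       _ = refl
lower-csub j u (t ⊙ t') e = let et , et' = ∨≡false⁻ e in cong₂ _⊙_ (lower-csub j u t et) (lower-csub j u t' et')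
lower-csub j u (t ᵒ)    _ = refl

csub0≡lower : ∀ u t → has0 t ≡ false → csub 0 u t ≡ lower t
csub0≡lower u (cvar (suc k)) _ = refl
csub0≡lower u cB             _ = refl
csub0≡lower u cI             _ = refl
csub0≡lower u (t ⊙ t')       e = let et , et' = ∨≡false⁻ e in cong₂ _⊙_ (csub0≡lower u t et) (csub0≡lower u t' et')
csub0≡lower u (t ᵒ)          _ = refl

-- The shape of T M for a planar body M: variable 0 occurs once, as the last variable.
data Abstractable : CTm → Set where
  var0   : Abstractable (cvar 0)
  in-fun : ∀ {t u} → Abstractable t → closedᵇ u ≡ true → Abstractable (t ⊙ u)
  in-arg : ∀ {t u} → has0 t ≡ false → Abstractable u → Abstractable (t ⊙ u)

abstractable-open : ∀ {t} → Abstractable t → closedᵇ t ≡ false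
abstractable-open var0         = refl
abstractable-open (in-fun g _) = ∧≡falseˡ (abstractable-open g)
abstractable-open (in-arg _ g) = ∧≡falseʳ (abstractable-open g)

Λ-closed-arg : ∀ t u → closedᵇ u ≡ true → Λ (t ⊙ u) ≡ cB ⊙ u ᵒ ⊙ Λ t
Λ-closed-arg t u e rewrite e = refl

Λ-open-arg : ∀ t u → closedᵇ u ≡ false → Λ (t ⊙ u) ≡ cB ⊙ lower t ⊙ Λ u
Λ-open-arg t u e rewrite e = refl

abstractable-cshift : ∀ c {t} → Abstractable t → Abstractable (cshift (suc c) t)
abstractable-cshift c var0                 = var0
abstractable-cshift c (in-fun {u = u} g e) = in-fun (abstractable-cshift c g) (trans (closedᵇ-cshift (suc c) u) e)
abstractable-cshift c (in-arg {t = t} n g) = in-arg (trans (has0-cshift c t) n) (abstractable-cshift c g)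

csub-open : ∀ j X {t} → Abstractable t → closedᵇ (csub (suc j) X t) ≡ false
csub-open j X var0         = refl
csub-open j X (in-fun g _) = ∧≡falseˡ (csub-open j X g)
csub-open j X (in-arg _ g) = ∧≡falseʳ (csub-open j X g)

Λ-cshift : ∀ c {t} → Abstractable t → Λ (cshift (suc c) t) ≡ cshift c (Λ t)
Λ-cshift c var0 = refl
Λ-cshift c (in-fun {t} {u} g e) = begin
  Λ (cshift (suc c) t ⊙ cshift (suc c) u)
    ≡⟨ Λ-closed-arg (cshift (suc c) t) (cshift (suc c) u) (trans (closedᵇ-cshift (suc c) u) e) ⟩
  cB ⊙ cshift (suc c) u ᵒ ⊙ Λ (cshift (suc c) t)
    ≡⟨ cong₂ (λ v s → cB ⊙ v ᵒ ⊙ s) (cshift-closed (suc c) u e) (Λ-cshift c g) ⟩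
  cshift c (cB ⊙ u ᵒ ⊙ Λ t)
    ≡⟨ cong (cshift c) (sym (Λ-closed-arg t u e)) ⟩
  cshift c (Λ (t ⊙ u)) ∎
Λ-cshift c (in-arg {t} {u} n g) = begin
  Λ (cshift (suc c) t ⊙ cshift (suc c) u)
    ≡⟨ Λ-open-arg (cshift (suc c) t) (cshift (suc c) u) (trans (closedᵇ-cshift (suc c) u) (abstractable-open g)) ⟩
  cB ⊙ lower (cshift (suc c) t) ⊙ Λ (cshift (suc c) u)
    ≡⟨ cong₂ (λ v s → cB ⊙ v ⊙ s) (lower-cshift c t n) (Λ-cshift c g) ⟩
  cshift c (cB ⊙ lower t ⊙ Λ u)
    ≡⟨ cong (cshift c) (sym (Λ-open-arg t u (abstractable-open g))) ⟩
  cshift c (Λ (t ⊙ u)) ∎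

Λ-csub : ∀ j v {t} → Abstractable t → Λ (csub (suc j) (cshift 0 v) t) ≡ csub j v (Λ t)
Λ-csub j v var0 = refl
Λ-csub j v (in-fun {t} {u} g e) = begin
  Λ (csub (suc j) v⁺ t ⊙ csub (suc j) v⁺ u)
    ≡⟨ cong (λ u' → Λ (csub (suc j) v⁺ t ⊙ u')) (csub-closed (suc j) v⁺ u e) ⟩
  Λ (csub (suc j) v⁺ t ⊙ u)
    ≡⟨ Λ-closed-arg (csub (suc j) v⁺ t) u e ⟩
  cB ⊙ u ᵒ ⊙ Λ (csub (suc j) v⁺ t)
    ≡⟨ cong (cB ⊙ u ᵒ ⊙_) (Λ-csub j v g) ⟩
  csub j v (cB ⊙ u ᵒ ⊙ Λ t)
    ≡⟨ cong (csub j v) (sym (Λ-closed-arg t u e)) ⟩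
  csub j v (Λ (t ⊙ u)) ∎
  where
  v⁺ : CTm
  v⁺ = cshift 0 v
Λ-csub j v (in-arg {t} {u} n g) = begin
  Λ (csub (suc j) v⁺ t ⊙ csub (suc j) v⁺ u)
    ≡⟨ Λ-open-arg (csub (suc j) v⁺ t) (csub (suc j) v⁺ u) (csub-open j v⁺ g) ⟩
  cB ⊙ lower (csub (suc j) v⁺ t) ⊙ Λ (csub (suc j) v⁺ u)
    ≡⟨ cong₂ (λ s s' → cB ⊙ s ⊙ s') (lower-csub j v t n) (Λ-csub j v g) ⟩
  csub j v (cB ⊙ lower t ⊙ Λ u)
    ≡⟨ cong (csub j v) (sym (Λ-open-arg t u (abstractable-open g))) ⟩
  csub j v (Λ (t ⊙ u)) ∎
  where
  v⁺ : CTm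
  v⁺ = cshift 0 v

-- The equational theory of extensional BI(_)•-algebras on combinatory terms

infix 4 _≈ᶜ_
data _≈ᶜ_ : CTm → CTm → Set where
  c-refl  : ∀ {a} → a ≈ᶜ a
  c-sym   : ∀ {a b} → a ≈ᶜ b → b ≈ᶜ a
  c-trans : ∀ {a b c} → a ≈ᶜ b → b ≈ᶜ c → a ≈ᶜ c
  c-app   : ∀ {a a' b b'} → a ≈ᶜ a' → b ≈ᶜ b' → a ⊙ b ≈ᶜ a' ⊙ b'
  c-dot   : ∀ {a a'} → a ≈ᶜ a' → a ᵒ ≈ᶜ a' ᵒ
  c-I     : ∀ {a} → cI ⊙ a ≈ᶜ a
  c-B     : ∀ {a b c} → cB ⊙ a ⊙ b ⊙ c ≈ᶜ a ⊙ (b ⊙ c)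
  c-•     : ∀ {a b} → closedᵇ a ≡ true → a ᵒ ⊙ b ≈ᶜ b ⊙ a
  c-BI    : cB ⊙ cI ≈ᶜ cI
  c-•∙    : ∀ {a b} → closedᵇ a ≡ true → closedᵇ b ≡ true → (a ⊙ b) ᵒ ≈ᶜ cB ⊙ b ᵒ ⊙ (cB ⊙ a ᵒ ⊙ cB)
  c-B•    : cB ⊙ cB ᵒ ⊙ (cB ⊙ cB ⊙ (cB ⊙ cB ⊙ cB)) ≈ᶜ cB ⊙ (cB ⊙ cB) ⊙ cB
  c-I•    : cB ⊙ cI ᵒ ⊙ cB ≈ᶜ cI
  c-••    : ∀ {a} → closedᵇ a ≡ true → cB ⊙ (a ᵒ) ᵒ ⊙ cB ≈ᶜ cB ⊙ (cB ⊙ a ᵒ) ⊙ cB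

infixr 4 _∘ᶜ_
_∘ᶜ_ : ∀ {a b c} → a ≈ᶜ b → b ≈ᶜ c → a ≈ᶜ c
_∘ᶜ_ = c-trans

≡⇒≈ᶜ : ∀ {a b} → a ≡ b → a ≈ᶜ b
≡⇒≈ᶜ refl = c-refl

appˡ : ∀ {a a' b} → a ≈ᶜ a' → a ⊙ b ≈ᶜ a' ⊙ b
appˡ p = c-app p c-refl

appʳ : ∀ {a b b'} → b ≈ᶜ b' → a ⊙ b ≈ᶜ a ⊙ b'
appʳ p = c-app c-refl p

eval-resp-≈ᶜ : (𝒜 : BIAlgebra) → ∀ {t t'} → t ≈ᶜ t' → BIAlgebra._≈_ 𝒜 (eval 𝒜 t) (eval 𝒜 t')
eval-resp-≈ᶜ 𝒜 c-refl        = IsEquivalence.refl isEquivalence where open BIAlgebra 𝒜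
eval-resp-≈ᶜ 𝒜 (c-sym p)     = IsEquivalence.sym isEquivalence (eval-resp-≈ᶜ 𝒜 p) where open BIAlgebra 𝒜
eval-resp-≈ᶜ 𝒜 (c-trans p q) =
  IsEquivalence.trans isEquivalence (eval-resp-≈ᶜ 𝒜 p) (eval-resp-≈ᶜ 𝒜 q) where open BIAlgebra 𝒜
eval-resp-≈ᶜ 𝒜 (c-app p q)   = BIAlgebra.∙-cong 𝒜 (eval-resp-≈ᶜ 𝒜 p) (eval-resp-≈ᶜ 𝒜 q)
eval-resp-≈ᶜ 𝒜 (c-dot p)     = BIAlgebra.•-cong 𝒜 (eval-resp-≈ᶜ 𝒜 p)
eval-resp-≈ᶜ 𝒜 c-I           = BIAlgebra.I-ax 𝒜 _
eval-resp-≈ᶜ 𝒜 c-B           = BIAlgebra.B-ax 𝒜 _ _ _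
eval-resp-≈ᶜ 𝒜 (c-• _)       = BIAlgebra.•-ax 𝒜 _ _
eval-resp-≈ᶜ 𝒜 c-BI          = BIAlgebra.BI-ax 𝒜
eval-resp-≈ᶜ 𝒜 (c-•∙ _ _)    = BIAlgebra.•∙-ax 𝒜 _ _
eval-resp-≈ᶜ 𝒜 c-B•          = BIAlgebra.B•-ax 𝒜
eval-resp-≈ᶜ 𝒜 c-I•          = BIAlgebra.I•-ax 𝒜
eval-resp-≈ᶜ 𝒜 (c-•• _)      = BIAlgebra.••-ax 𝒜 _

vars-resp-≈ᶜ : ∀ {t t'} → t ≈ᶜ t' → vars t ≡ vars t'
vars-resp-≈ᶜ c-refl                  = refl
vars-resp-≈ᶜ (c-sym p)               = sym (vars-resp-≈ᶜ p)
vars-resp-≈ᶜ (c-trans p q)           = trans (vars-resp-≈ᶜ p) (vars-resp-≈ᶜ q)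
vars-resp-≈ᶜ (c-app p q)             = cong₂ _++_ (vars-resp-≈ᶜ p) (vars-resp-≈ᶜ q)
vars-resp-≈ᶜ (c-dot p)               = vars-resp-≈ᶜ p
vars-resp-≈ᶜ c-I                     = refl
vars-resp-≈ᶜ (c-B {a} {b} {c})       = ++-assoc (vars a) (vars b) (vars c)
vars-resp-≈ᶜ (c-• {a} {b} e)         rewrite closed⇒vars≡[] a e = sym (++-identityʳ (vars b))
vars-resp-≈ᶜ c-BI                    = refl
vars-resp-≈ᶜ (c-•∙ {a} {b} e₁ e₂)    rewrite closed⇒vars≡[] a e₁ | closed⇒vars≡[] b e₂ = refl
vars-resp-≈ᶜ c-B•                    = refl
vars-resp-≈ᶜ c-I•                    = refl
vars-resp-≈ᶜ (c-•• {a} e)            rewrite closed⇒vars≡[] a e = refl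

closedᵇ-resp-≈ᶜ : ∀ {t t'} → t ≈ᶜ t' → closedᵇ t ≡ closedᵇ t'
closedᵇ-resp-≈ᶜ {t} {t'} p = begin
  closedᵇ t          ≡⟨ closedᵇ≡null-vars t ⟩
  null (vars t)      ≡⟨ cong null (vars-resp-≈ᶜ p) ⟩
  null (vars t')     ≡⟨ sym (closedᵇ≡null-vars t') ⟩
  closedᵇ t'         ∎

has0-resp-≈ᶜ : ∀ {t t'} → t ≈ᶜ t' → has0 t ≡ has0 t'
has0-resp-≈ᶜ c-refl            = refl
has0-resp-≈ᶜ (c-sym p)         = sym (has0-resp-≈ᶜ p)
has0-resp-≈ᶜ (c-trans p q)     = trans (has0-resp-≈ᶜ p) (has0-resp-≈ᶜ q)
has0-resp-≈ᶜ (c-app p q)       = cong₂ _∨_ (has0-resp-≈ᶜ p) (has0-resp-≈ᶜ q)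
has0-resp-≈ᶜ (c-dot p)         = refl
has0-resp-≈ᶜ c-I               = refl
has0-resp-≈ᶜ (c-B {a} {b} {c}) = ∨-assoc (has0 a) (has0 b) (has0 c)
has0-resp-≈ᶜ (c-• {a} {b} e)   rewrite closed⇒has0≡false a e = sym (∨-identityʳ (has0 b))
has0-resp-≈ᶜ c-BI              = refl
has0-resp-≈ᶜ (c-•∙ _ _)        = refl
has0-resp-≈ᶜ c-B•              = refl
has0-resp-≈ᶜ c-I•              = refl
has0-resp-≈ᶜ (c-•• _)          = refl

DotsClosed-resp-≈ᶜ : ∀ {t t'} → t ≈ᶜ t' → DotsClosed t ⇔ DotsClosed t'
DotsClosed-resp-≈ᶜ c-refl        = ⇔-id _
DotsClosed-resp-≈ᶜ (c-sym p)     = ⇔-sym (DotsClosed-resp-≈ᶜ p)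
DotsClosed-resp-≈ᶜ (c-trans p q) = DotsClosed-resp-≈ᶜ q ⇔-∘ DotsClosed-resp-≈ᶜ p
DotsClosed-resp-≈ᶜ (c-app p q)   =
  mk⇔ (λ (wa , wb) → to (DotsClosed-resp-≈ᶜ p) wa , to (DotsClosed-resp-≈ᶜ q) wb)
      (λ (wa , wb) → from (DotsClosed-resp-≈ᶜ p) wa , from (DotsClosed-resp-≈ᶜ q) wb)
DotsClosed-resp-≈ᶜ (c-dot p)     = mk⇔ (trans (sym (closedᵇ-resp-≈ᶜ p))) (trans (closedᵇ-resp-≈ᶜ p))
DotsClosed-resp-≈ᶜ c-I           = mk⇔ proj₂ (tt ,_)
DotsClosed-resp-≈ᶜ c-B           =
  mk⇔ (λ (((_ , wa) , wb) , wc) → wa , wb , wc) (λ (wa , wb , wc) → ((tt , wa) , wb) , wc)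
DotsClosed-resp-≈ᶜ (c-• {a} e)   = mk⇔ (λ (_ , wb) → wb , closed⇒DotsClosed a e) (λ (wb , _) → e , wb)
DotsClosed-resp-≈ᶜ c-BI          = mk⇔ _ _
DotsClosed-resp-≈ᶜ (c-•∙ e₁ e₂)  =
  mk⇔ (λ _ → (tt , e₂) , (tt , e₁) , tt) (λ _ → ∧≡true⁺ e₁ e₂)
DotsClosed-resp-≈ᶜ c-B•          = mk⇔ _ (λ _ → (tt , refl) , (tt , tt) , (tt , tt) , tt)
DotsClosed-resp-≈ᶜ c-I•          = mk⇔ _ (λ _ → (tt , refl) , tt)
DotsClosed-resp-≈ᶜ (c-•• e)      = mk⇔ (λ _ → (tt , tt , e) , tt) (λ _ → (tt , e) , tt)

lower-resp-≈ᶜ : ∀ {t t'} → t ≈ᶜ t' → lower t ≈ᶜ lower t'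
lower-resp-≈ᶜ c-refl        = c-refl
lower-resp-≈ᶜ (c-sym p)     = c-sym (lower-resp-≈ᶜ p)
lower-resp-≈ᶜ (c-trans p q) = lower-resp-≈ᶜ p ∘ᶜ lower-resp-≈ᶜ q
lower-resp-≈ᶜ (c-app p q)   = c-app (lower-resp-≈ᶜ p) (lower-resp-≈ᶜ q)
lower-resp-≈ᶜ (c-dot p)     = c-dot p
lower-resp-≈ᶜ c-I           = c-I
lower-resp-≈ᶜ c-B           = c-B
lower-resp-≈ᶜ (c-• {a} e)   = c-• e ∘ᶜ appʳ (≡⇒≈ᶜ (sym (lower-closed a e)))
lower-resp-≈ᶜ c-BI          = c-BI
lower-resp-≈ᶜ (c-•∙ e₁ e₂)  = c-•∙ e₁ e₂
lower-resp-≈ᶜ c-B•          = c-B•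
lower-resp-≈ᶜ c-I•          = c-I•
lower-resp-≈ᶜ (c-•• e)      = c-•• e

++≡map-suc⁻ : ∀ (as bs Γ : List ℕ) → as ++ bs ≡ map suc Γ →
              ∃ λ Γ₁ → ∃ λ Γ₂ → as ≡ map suc Γ₁ × bs ≡ map suc Γ₂
++≡map-suc⁻ []       bs Γ       e = [] , Γ , refl , e
++≡map-suc⁻ (a ∷ as) bs (g ∷ Γ) e with refl , e′ ← ∷-injective e =
  let Γ₁ , Γ₂ , e₁ , e₂ = ++≡map-suc⁻ as bs Γ e′ in g ∷ Γ₁ , Γ₂ , cong (suc g ∷_) e₁ , e₂

++≡⇑⁻ : ∀ (as : List ℕ) b bs Γ → as ++ b ∷ bs ≡ ⇑ Γ →
        ∃ λ Γ₁ → ∃ λ Γ₂ → as ≡ map suc Γ₁ × b ∷ bs ≡ ⇑ Γ₂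
++≡⇑⁻ []       b bs Γ       e = [] , Γ , refl , e
++≡⇑⁻ (a ∷ as) b bs []      e with () ← ++-conicalʳ as (b ∷ bs) (proj₂ (∷-injective e))
++≡⇑⁻ (a ∷ as) b bs (g ∷ Γ) e with refl , e′ ← ∷-injective e =
  let Γ₁ , Γ₂ , e₁ , e₂ = ++≡⇑⁻ as b bs Γ e′ in g ∷ Γ₁ , Γ₂ , cong (suc g ∷_) e₁ , e₂

[]≢⇑ : ∀ Γ → [] ≢ ⇑ Γ
[]≢⇑ []      ()
[]≢⇑ (_ ∷ _) ()

has0≡false-from-vars : ∀ t Γ → vars t ≡ map suc Γ → has0 t ≡ false
has0≡false-from-vars (cvar (suc k)) Γ _ = refl
has0≡false-from-vars cB             Γ _ = refl
has0≡false-from-vars cI             Γ _ = refl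
has0≡false-from-vars (t ⊙ u)        Γ e =
  let Γ₁ , Γ₂ , e₁ , e₂ = ++≡map-suc⁻ (vars t) (vars u) Γ e
  in cong₂ _∨_ (has0≡false-from-vars t Γ₁ e₁) (has0≡false-from-vars u Γ₂ e₂)
has0≡false-from-vars (t ᵒ)          Γ _ = refl
has0≡false-from-vars (cvar zero) (_ ∷ _) ()

vars-lower : ∀ t → has0 t ≡ false → DotsClosed t → vars t ≡ map suc (vars (lower t))
vars-lower (cvar (suc k)) _ _ = refl
vars-lower cB             _ _ = refl
vars-lower cI             _ _ = refl
vars-lower (t ⊙ u)        e (wt , wu) =
  let et , eu = ∨≡false⁻ e in
  trans (cong₂ _++_ (vars-lower t et wt) (vars-lower u eu wu)) (sym (map-++ suc (vars (lower t)) (vars (lower u))))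
vars-lower (t ᵒ)          _ w rewrite closed⇒vars≡[] t w = refl

abstractable-from-vars : ∀ t Γ → DotsClosed t → vars t ≡ ⇑ Γ → Abstractable t
abstractable-from-vars (cvar zero)    []      _ _ = var0
abstractable-from-vars (cvar zero)    (_ ∷ _) _ e with () ← ∷-injective e
abstractable-from-vars (cvar (suc k)) (_ ∷ Γ) _ e = ⊥-elim ([]≢⇑ Γ (proj₂ (∷-injective e)))
abstractable-from-vars cB             Γ       _ e = ⊥-elim ([]≢⇑ Γ e)
abstractable-from-vars cI             Γ       _ e = ⊥-elim ([]≢⇑ Γ e)
abstractable-from-vars (t ᵒ)          Γ       w e = ⊥-elim ([]≢⇑ Γ (trans (sym (closed⇒vars≡[] t w)) e))
abstractable-from-vars (t ⊙ u)        Γ (wt , wu) e with vars u in eu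
... | [] = in-fun (abstractable-from-vars t Γ wt (trans (sym (++-identityʳ (vars t))) e)) (vars≡[]⇒closed u eu)
... | b ∷ bs =
  let Γ₁ , Γ₂ , e₁ , e₂ = ++≡⇑⁻ (vars t) b bs Γ e
  in in-arg (has0≡false-from-vars t Γ₁ e₁) (abstractable-from-vars u Γ₂ wu (trans eu e₂))

vars-Λ : ∀ {t} → Abstractable t → DotsClosed t → vars t ≡ ⇑ vars (Λ t)
vars-Λ var0 _ = refl
vars-Λ (in-fun {t} {u} g e) (wt , _) rewrite Λ-closed-arg t u e | closed⇒vars≡[] u e =
  trans (++-identityʳ (vars t)) (vars-Λ g wt)
vars-Λ (in-arg {t} {u} n g) (wt , wu) rewrite Λ-open-arg t u (abstractable-open g) =
  trans (cong₂ _++_ (vars-lower t n wt) (vars-Λ g wu)) (⇑-++ (vars (lower t)) (vars (Λ u)))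

vars-Λ-⇑ : ∀ {Γ t} → Abstractable t → DotsClosed t → vars t ≡ ⇑ Γ → vars (Λ t) ≡ Γ
vars-Λ-⇑ {Γ} g w e = ⇑-injective _ Γ (trans (sym (vars-Λ g w)) e)

abstractable-resp-≈ᶜ : ∀ {t t'} → t ≈ᶜ t' → Abstractable t → DotsClosed t → DotsClosed t' → Abstractable t'
abstractable-resp-≈ᶜ {t' = t'} p g w w' = abstractable-from-vars t' _ w' (trans (sym (vars-resp-≈ᶜ p)) (vars-Λ g w))

-- Λ-cong needs these laws, obtained from the axioms B•, •• and •∙, for instances of
-- the B axiom in which variable 0 lies in the first or second argument.
B-B-distrib : ∀ p q → cB ⊙ (cB ⊙ p ⊙ q) ≈ᶜ cB ⊙ (cB ⊙ p) ⊙ (cB ⊙ q)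
B-B-distrib p q =
  c-sym (appˡ c-B ∘ᶜ c-B)
  ∘ᶜ appˡ (appˡ (c-sym c-B•))
  ∘ᶜ appˡ (c-B ∘ᶜ c-• refl ∘ᶜ appˡ c-B)
  ∘ᶜ c-B ∘ᶜ appˡ c-B

B-B-assoc : ∀ p q f → cB ⊙ (cB ⊙ p ⊙ q) ⊙ f ≈ᶜ cB ⊙ p ⊙ (cB ⊙ q ⊙ f)
B-B-assoc p q f = appˡ (B-B-distrib p q) ∘ᶜ c-B

B•-comm : ∀ c p → closedᵇ c ≡ true → cB ⊙ c ᵒ ⊙ (cB ⊙ p) ≈ᶜ cB ⊙ p ⊙ c ᵒ
B•-comm c p e = c-sym c-B ∘ᶜ c-sym (appˡ (c-•• e)) ∘ᶜ c-B ∘ᶜ c-• e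

B•-comm-assoc : ∀ c p g → closedᵇ c ≡ true → cB ⊙ c ᵒ ⊙ (cB ⊙ (cB ⊙ p) ⊙ g) ≈ᶜ cB ⊙ p ⊙ (cB ⊙ c ᵒ ⊙ g)
B•-comm-assoc c p g e = c-sym (B-B-assoc (c ᵒ) (cB ⊙ p) g) ∘ᶜ appˡ (appʳ (B•-comm c p e)) ∘ᶜ B-B-assoc p (c ᵒ) g

B•-app : ∀ b c f → closedᵇ b ≡ true → closedᵇ c ≡ true →
         cB ⊙ c ᵒ ⊙ (cB ⊙ b ᵒ ⊙ (cB ⊙ cB ⊙ f)) ≈ᶜ cB ⊙ (b ⊙ c) ᵒ ⊙ f
B•-app b c f e₁ e₂ = c-sym (appˡ (appʳ (c-•∙ e₁ e₂)) ∘ᶜ B-B-assoc (c ᵒ) (cB ⊙ b ᵒ ⊙ cB) f ∘ᶜ appʳ (B-B-assoc (b ᵒ) cB f))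

B-I-η : ∀ t → cB ⊙ t ⊙ cI ≈ᶜ t
B-I-η t = c-sym (c-B ∘ᶜ c-• refl) ∘ᶜ appˡ c-I• ∘ᶜ c-I

Λ-β : ∀ {t} u → Abstractable t → Λ t ⊙ u ≈ᶜ csub 0 u t
Λ-β u var0 = c-I
Λ-β u (in-fun {t} {v} g e) =
  appˡ (≡⇒≈ᶜ (Λ-closed-arg t v e)) ∘ᶜ c-B ∘ᶜ c-• e ∘ᶜ c-app (Λ-β u g) (≡⇒≈ᶜ (sym (csub-closed 0 u v e)))
Λ-β u (in-arg {t} {v} n g) =
  appˡ (≡⇒≈ᶜ (Λ-open-arg t v (abstractable-open g))) ∘ᶜ c-B ∘ᶜ c-app (≡⇒≈ᶜ (sym (csub0≡lower u t n))) (Λ-β u g)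

Λ-cong : ∀ {t t'} → t ≈ᶜ t' → Abstractable t → DotsClosed t → DotsClosed t' → Λ t ≈ᶜ Λ t'
Λ-cong c-refl _ _ _ = c-refl
Λ-cong (c-sym p) g w w' = c-sym (Λ-cong p (abstractable-resp-≈ᶜ (c-sym p) g w w') w' w)
Λ-cong (c-trans p q) g w w' =
  let wm = to (DotsClosed-resp-≈ᶜ p) w in
  Λ-cong p g w wm ∘ᶜ Λ-cong q (abstractable-resp-≈ᶜ p g w wm) wm w'
Λ-cong (c-app {a} {a'} {b} {b'} p q) (in-fun ga cb) (wa , _) (wa' , _) =
  ≡⇒≈ᶜ (Λ-closed-arg a b cb)
  ∘ᶜ c-app (appʳ (c-dot q)) (Λ-cong p ga wa wa')
  ∘ᶜ ≡⇒≈ᶜ (sym (Λ-closed-arg a' b' (trans (sym (closedᵇ-resp-≈ᶜ q)) cb)))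
Λ-cong (c-app {a} {a'} {b} {b'} p q) (in-arg na gb) (_ , wb) (_ , wb') =
  ≡⇒≈ᶜ (Λ-open-arg a b (abstractable-open gb))
  ∘ᶜ c-app (appʳ (lower-resp-≈ᶜ p)) (Λ-cong q gb wb wb')
  ∘ᶜ ≡⇒≈ᶜ (sym (Λ-open-arg a' b' (abstractable-open (abstractable-resp-≈ᶜ q gb wb wb'))))
Λ-cong (c-I {a}) (in-arg _ ga) _ _ = ≡⇒≈ᶜ (Λ-open-arg cI a (abstractable-open ga)) ∘ᶜ appˡ c-BI ∘ᶜ c-I
Λ-cong (c-B {a} {b} {c}) (in-arg _ gc) _ _ =
  ≡⇒≈ᶜ (Λ-open-arg (cB ⊙ a ⊙ b) c oc)
  ∘ᶜ B-B-assoc (lower a) (lower b) (Λ c)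
  ∘ᶜ appʳ (≡⇒≈ᶜ (sym (Λ-open-arg b c oc)))
  ∘ᶜ ≡⇒≈ᶜ (sym (Λ-open-arg a (b ⊙ c) (∧≡falseʳ oc)))
  where
  oc : closedᵇ c ≡ false
  oc = abstractable-open gc
Λ-cong (c-B {a} {b} {c}) (in-fun (in-fun (in-arg _ ga) cb) cc) _ _ =
  ≡⇒≈ᶜ (Λ-closed-arg (cB ⊙ a ⊙ b) c cc)
  ∘ᶜ appʳ (≡⇒≈ᶜ (Λ-closed-arg (cB ⊙ a) b cb) ∘ᶜ appʳ (≡⇒≈ᶜ (Λ-open-arg cB a (abstractable-open ga))))
  ∘ᶜ B•-app b c (Λ a) cb cc
  ∘ᶜ ≡⇒≈ᶜ (sym (Λ-closed-arg a (b ⊙ c) (∧≡true⁺ cb cc)))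
Λ-cong (c-B {a} {b} {c}) (in-fun (in-arg _ gb) cc) _ _ =
  ≡⇒≈ᶜ (Λ-closed-arg (cB ⊙ a ⊙ b) c cc)
  ∘ᶜ appʳ (≡⇒≈ᶜ (Λ-open-arg (cB ⊙ a) b ob))
  ∘ᶜ B•-comm-assoc c (lower a) (Λ b) cc
  ∘ᶜ appʳ (≡⇒≈ᶜ (sym (Λ-closed-arg b c cc)))
  ∘ᶜ ≡⇒≈ᶜ (sym (Λ-open-arg a (b ⊙ c) (∧≡falseˡ ob)))
  where
  ob : closedᵇ b ≡ false
  ob = abstractable-open gb
Λ-cong (c-• {a} {b} e) (in-arg _ gb) _ _ = ≡⇒≈ᶜ (Λ-open-arg (a ᵒ) b (abstractable-open gb)) ∘ᶜ ≡⇒≈ᶜ (sym (Λ-closed-arg b a e))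
Λ-cong c-BI g _ _ with () ← abstractable-open g
Λ-cong c-B• g _ _ with () ← abstractable-open g
Λ-cong c-I• g _ _ with () ← abstractable-open g
Λ-cong (c-•• _) (in-fun (in-fun () _) _) _ _

-- Soundness of the translation

lower-DotsClosed : ∀ t → DotsClosed t → DotsClosed (lower t)
lower-DotsClosed (cvar _) _         = tt
lower-DotsClosed cB       _         = tt
lower-DotsClosed cI       _         = tt
lower-DotsClosed (t ⊙ u)  (wt , wu) = lower-DotsClosed t wt , lower-DotsClosed u wu
lower-DotsClosed (t ᵒ)    w         = w

T-DotsClosed : ∀ M → DotsClosed (T M)
T-DotsClosed (var k)   = tt
T-DotsClosed (app M N) = T-DotsClosed M , T-DotsClosed N
T-DotsClosed (lam M)   = Λ-DotsClosed (T M) (T-DotsClosed M)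
  where
  Λ-DotsClosed : ∀ t → DotsClosed t → DotsClosed (Λ t)
  Λ-DotsClosed (cvar zero)    _ = tt
  Λ-DotsClosed (cvar (suc k)) _ = tt
  Λ-DotsClosed cB             _ = tt
  Λ-DotsClosed cI             _ = tt
  Λ-DotsClosed (t ᵒ)          w = w
  Λ-DotsClosed (t ⊙ u) (wt , wu) with closedᵇ u in cu
  ... | true  = (tt , cu) , Λ-DotsClosed t wt
  ... | false = (tt , lower-DotsClosed t wt) , Λ-DotsClosed u wu

BodiesAbstractable : Term → Set
BodiesAbstractable (var _)   = ⊤
BodiesAbstractable (lam M)   = Abstractable (T M) × BodiesAbstractable M
BodiesAbstractable (app M N) = BodiesAbstractable M × BodiesAbstractable N

T-shift : ∀ c M → BodiesAbstractable M → T (shift c M) ≡ cshift c (T M)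
T-shift c (var k)   _        = cong T (shift-var c k)
T-shift c (lam M)   (g , bM) = trans (cong Λ (T-shift (suc c) M bM)) (Λ-cshift c g)
T-shift c (app M N) (bM , bN) = cong₂ _⊙_ (T-shift c M bM) (T-shift c N bN)

BodiesAbstractable-shift : ∀ c M → BodiesAbstractable M → BodiesAbstractable (shift c M)
BodiesAbstractable-shift c (var k) _ = ≡.subst BodiesAbstractable (sym (shift-var c k)) tt
BodiesAbstractable-shift c (lam M) (g , bM) =
  ≡.subst Abstractable (sym (T-shift (suc c) M bM)) (abstractable-cshift c g) , BodiesAbstractable-shift (suc c) M bM
BodiesAbstractable-shift c (app M N) (bM , bN) = BodiesAbstractable-shift c M bM , BodiesAbstractable-shift c N bN

T-subst : ∀ j N M → BodiesAbstractable M → BodiesAbstractable N → T (subst j N M) ≡ csub j (T N) (T M)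
T-subst j N (var k) _ _ with k <ᵇ j
... | true = refl
... | false with k ≡ᵇ j
...   | true  = refl
...   | false = refl
T-subst j N (lam M) (g , bM) bN = begin
  Λ (T (subst (suc j) (shift 0 N) M))    ≡⟨ cong Λ (T-subst (suc j) (shift 0 N) M bM (BodiesAbstractable-shift 0 N bN)) ⟩
  Λ (csub (suc j) (T (shift 0 N)) (T M)) ≡⟨ cong (λ u → Λ (csub (suc j) u (T M))) (T-shift 0 N bN) ⟩
  Λ (csub (suc j) (cshift 0 (T N)) (T M)) ≡⟨ Λ-csub j (T N) g ⟩
  csub j (T N) (Λ (T M))                 ∎
T-subst j N (app M M') (bM , bM') bN = cong₂ _⊙_ (T-subst j N M bM bN) (T-subst j N M' bM' bN)

planar-vars-T : ∀ {Γ M} → Planar Γ M → vars (T M) ≡ Γ × BodiesAbstractable M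
planar-vars-T pvar       = refl , tt
planar-vars-T (papp p q) =
  let vM , bM = planar-vars-T p ; vN , bN = planar-vars-T q in cong₂ _++_ vM vN , bM , bN
planar-vars-T {Γ} (plam {M = M} p) =
  let vM , bM = planar-vars-T p
      g = abstractable-from-vars (T M) Γ (T-DotsClosed M) vM
  in vars-Λ-⇑ g (T-DotsClosed M) vM , g , bM

planar-body-abstractable : ∀ {Γ M} → Planar (⇑ Γ) M → Abstractable (T M)
planar-body-abstractable {Γ} {M} p = abstractable-from-vars (T M) Γ (T-DotsClosed M) (proj₁ (planar-vars-T p))

T-sound : ∀ {Γ M N} → Γ ⊢ M ≐ N → T M ≈ᶜ T N × vars (T M) ≡ Γ
T-sound (≐-refl p) = c-refl , proj₁ (planar-vars-T p)
T-sound (≐-sym e) =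
  let r , v = T-sound e in c-sym r , trans (sym (vars-resp-≈ᶜ r)) v
T-sound (≐-trans e f) =
  let r , v = T-sound e ; s , _ = T-sound f in (r ∘ᶜ s) , v
T-sound (≐-lam {M = M} {M' = M'} e) =
  let r , v = T-sound e
      g = abstractable-from-vars (T M) _ (T-DotsClosed M) v
  in Λ-cong r g (T-DotsClosed M) (T-DotsClosed M') , vars-Λ-⇑ g (T-DotsClosed M) v
T-sound (≐-app e f) =
  let r , v = T-sound e ; s , u = T-sound f in c-app r s , cong₂ _++_ v u
T-sound (≐-β {M = M} {N = N} p q) =
  let vM , bM = planar-vars-T p ; vN , bN = planar-vars-T q
      g = planar-body-abstractable p
  in (Λ-β (T N) g ∘ᶜ ≡⇒≈ᶜ (sym (T-subst 0 N M bM bN))) , cong₂ _++_ (vars-Λ-⇑ g (T-DotsClosed M) vM) vN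
T-sound (≐-η {M = M} p) =
  let vM , bM = planar-vars-T p
      r = appˡ (appʳ (≡⇒≈ᶜ (trans (cong lower (T-shift 0 M bM)) (lower-cshift0 (T M))))) ∘ᶜ B-I-η (T M)
  in r , trans (vars-resp-≈ᶜ r) vM

-- Completeness: reading combinatory terms back as λ-terms

toTerm : CTm → Term
toTerm (cvar k) = var k
toTerm cB       = Bᵗ
toTerm cI       = Iᵗ
toTerm (t ⊙ u)  = app (toTerm t) (toTerm u)
toTerm (t ᵒ)    = toTerm t •ᵗ

toTerm-planar : ∀ t → DotsClosed t → Planar (vars t) (toTerm t)
toTerm-planar (cvar k) _         = pvar
toTerm-planar cB       _         = Bᵗ-planar
toTerm-planar cI       _         = Iᵗ-planar
toTerm-planar (t ⊙ u)  (wt , wu) = papp (toTerm-planar t wt) (toTerm-planar u wu)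
toTerm-planar (t ᵒ)    w         =
  cast-planar (sym vt) (•ᵗ-planar (cast-planar vt (toTerm-planar t (closed⇒DotsClosed t w))))
  where
  vt : vars t ≡ []
  vt = closed⇒vars≡[] t w

toTerm-closed : ∀ t → closedᵇ t ≡ true → Planar [] (toTerm t)
toTerm-closed t e = cast-planar (closed⇒vars≡[] t e) (toTerm-planar t (closed⇒DotsClosed t e))

toTerm-lower : ∀ t → has0 t ≡ false → DotsClosed t → toTerm t ≡ shift 0 (toTerm (lower t))
toTerm-lower (cvar (suc k)) _ _ = refl
toTerm-lower cB             _ _ = refl
toTerm-lower cI             _ _ = refl
toTerm-lower (t ⊙ u)        e (wt , wu) =
  let et , eu = ∨≡false⁻ e in cong₂ app (toTerm-lower t et wt) (toTerm-lower u eu wu)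
toTerm-lower (t ᵒ)          _ w = sym (cong (λ a → lam (app (var 0) a)) (shift-closed 1 (toTerm-closed t w)))

toTerm-Λ : ∀ {t} → Abstractable t → DotsClosed t → vars (Λ t) ⊢ toTerm (Λ t) ≐ lam (toTerm t)
toTerm-Λ var0 _ = ≐-refl Iᵗ-planar
toTerm-Λ (in-fun {t} {u} g e) (wt , _) rewrite Λ-closed-arg t u e | closed⇒vars≡[] u e =
  ≐-app {Γ = []} {Δ = vars (Λ t)} (≐-refl (papp Bᵗ-planar (•ᵗ-planar pu))) (toTerm-Λ g wt)
  ⨾ ≐-≡ʳ (cong (λ a → lam (app a (toTerm t))) (shift-closed 0 (•ᵗ-planar pu)))
      (Bᵗ-app-lam {Γ₁ = []} {Γ₂ = vars (Λ t)} (•ᵗ-planar pu) pt)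
  ⨾ ≐-lam {Γ = vars (Λ t)}
      (≐-β≡ {Γ = []} {Δ = ⇑ vars (Λ t)} (papp pvar pu) pt (cong (app (toTerm t)) (subst-closed 0 (toTerm t) pu)))
  where
  pu : Planar [] (toTerm u)
  pu = toTerm-closed u e
  pt : Planar (⇑ vars (Λ t)) (toTerm t)
  pt = cast-planar (vars-Λ g wt) (toTerm-planar t wt)
toTerm-Λ (in-arg {t} {u} n g) (wt , wu) rewrite Λ-open-arg t u (abstractable-open g) =
  ≐-app {Γ = vars (lower t)} {Δ = vars (Λ u)} (≐-refl (papp Bᵗ-planar pt)) (toTerm-Λ g wu)
  ⨾ ≐-≡ʳ (cong (λ a → lam (app a (toTerm u))) (sym (toTerm-lower t n wt))) (Bᵗ-app-lam pt pu)
  where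
  pt : Planar (vars (lower t)) (toTerm (lower t))
  pt = toTerm-planar (lower t) (lower-DotsClosed t wt)
  pu : Planar (⇑ vars (Λ u)) (toTerm u)
  pu = cast-planar (vars-Λ g wu) (toTerm-planar u wu)

toTerm-T : ∀ {Γ M} → Planar Γ M → Γ ⊢ toTerm (T M) ≐ M
toTerm-T pvar       = ≐-refl pvar
toTerm-T (papp p q) = ≐-app (toTerm-T p) (toTerm-T q)
toTerm-T {Γ} (plam {M = M} p) =
  let vM = proj₁ (planar-vars-T p)
      g  = abstractable-from-vars (T M) Γ (T-DotsClosed M) vM
  in cast-≐ (vars-Λ-⇑ g (T-DotsClosed M) vM) (toTerm-Λ g (T-DotsClosed M)) ⨾ ≐-lam (toTerm-T p)

eval-termModel : ∀ t → closedᵇ t ≡ true → proj₁ (eval termModel t) ≡ toTerm t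
eval-termModel cB      _ = refl
eval-termModel cI      _ = refl
eval-termModel (t ⊙ u) e = let et , eu = ∧≡true⁻ e in cong₂ app (eval-termModel t et) (eval-termModel u eu)
eval-termModel (t ᵒ)   e = cong _•ᵗ (eval-termModel t e)

⟦⟧-termModel : ∀ {M} → Planar [] M → [] ⊢ proj₁ (⟦ M ⟧ termModel) ≐ M
⟦⟧-termModel {M} p =
  ≡.subst (λ N → [] ⊢ N ≐ M) (sym (eval-termModel (T M) (vars≡[]⇒closed (T M) (proj₁ (planar-vars-T p))))) (toTerm-T p)

proposition3p3 : (M N : Term) → Planar [] M → Planar [] N →
    ([] ⊢ M ≐ N) ⇔ ((𝒜 : BIAlgebra) → BIAlgebra._≈_ 𝒜 (⟦ M ⟧ 𝒜) (⟦ N ⟧ 𝒜))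
proposition3p3 M N pM pN = mk⇔
  (λ M≐N 𝒜 → eval-resp-≈ᶜ 𝒜 (proj₁ (T-sound M≐N)))
  (λ ⟦M⟧≈⟦N⟧ → ≐-sym (⟦⟧-termModel pM) ⨾ ⟦M⟧≈⟦N⟧ termModel ⨾ ⟦⟧-termModel pN)
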